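{- Let $G$ be a strongly connected, deterministic and co-deterministic graph. Then for all $s,t\in V_G$, $G$ is isomorphic to the canonical graph $\overrightarrow{\mathrm{L}_G(s,t)}$.
   Context: Fix an arbitrary set $A$ of labels; $A^*$ is the free monoid of words over $A$. A graph is a non-empty set $G\subseteq V\times A\times V$ of labelled edges $s\xrightarrow{a}t$; $V_G$ is the set of vertices occurring in edges. Isomorphism: bijection $f:V_G\to V_H$ with $s\xrightarrow{a}_G t\iff f(s)\xrightarrow{a}_H f(t)$. $G$ is deterministic if $r\xrightarrow{a}s,\ r\xrightarrow{a}t\Rightarrow s=t$; co-deterministic if $s\xrightarrow{a}r,\ t\xrightarrow{a}r\Rightarrow s=t$; strongly connected if every vertex reaches every vertex by a directed path. For $u=a_1\cdots a_n$, $s\xrightarrow{u}t$ means there is a path $s=s_0\xrightarrow{a_1}s_1\cdots\xrightarrow{a_n}s_n=t$, and $\mathrm{L}_G(s,t)=\{u\in A^*\mid s\xrightarrow{u}t\}$. For a language $L\subseteq A^*$ and $u\in A^*$, $u^{ -1}L=\{v\mid uv\in L\}$. The canonical graph of $L$ is $\overrightarrow{L}=\{(u^{ -1}L,\,a,\,(ua)^{ -1}L)\mid u\in A^*,a\in A,(ua)^{ -1}L\neq\emptyset\}$ (vertices are non-empty residuals of $L$). -}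

module Defs where

open import Data.List using (List; []; _∷_; _++_; [_])
open import Data.Product using (Σ; ∃; ∃-syntax; _×_; _,_; proj₁)
open import Data.Sum using (_⊎_)
open import Relation.Binary.PropositionalEquality using (_≡_)
open import Function.Bundles using (_⇔_)

-- Vertex equality is a relation _≈_
-- on V (propositional equality for concrete graphs; extensional equality of
-- languages for canonical graphs, whose vertices are languages).

-- V_G : the vertices occurring in some edge
Occurs : {A V : Set} → (V → A → V → Set) → V → Set
Occurs {A} {V} E v = ∃[ a ] ∃[ w ] (E v a w ⊎ E w a v)

VertexSet : {A V : Set} → (V → A → V → Set) → Set
VertexSet {V = V} E = Σ V (Occurs E)

data Path {A V : Set} (E : V → A → V → Set) : V → List A → V → Set where
  nil  : ∀ {s} → Path E s [] s
  cons : ∀ {s a r u t} → E s a r → Path E r u t → Path E s (a ∷ u) t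

Deterministic : {A V : Set} → (V → A → V → Set) → Set
Deterministic E = ∀ {r a s t} → E r a s → E r a t → s ≡ t

CoDeterministic : {A V : Set} → (V → A → V → Set) → Set
CoDeterministic E = ∀ {s a r t} → E s a r → E t a r → s ≡ t

StronglyConnected : {A V : Set} → (V → A → V → Set) → Set
StronglyConnected E =
  (r s : VertexSet E) → ∃[ u ] Path E (proj₁ r) u (proj₁ s)

Language : Set → Set₁
Language A = List A → Set

PathLanguage : {A V : Set} → (V → A → V → Set) → V → V → Language A
PathLanguage E s t u = Path E s u t

_≐_ : {A : Set} → Language A → Language A → Set
L ≐ K = ∀ w → L w ⇔ K w

NonEmpty : {A : Set} → Language A → Set
NonEmpty L = ∃[ w ] L w

residual : {A : Set} → List A → Language A → Language A
residual u L v = L (u ++ v)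

-- Canonical graph of L: vertices are languages (compared up to ≐);
-- edges are the triples (u⁻¹L, a, (ua)⁻¹L) with (ua)⁻¹L non-empty.
CanonEdge : {A : Set} → Language A → Language A → A → Language A → Set
CanonEdge L X a Y =
  ∃[ u ] (X ≐ residual u L) × (Y ≐ residual (u ++ [ a ]) L)
       × NonEmpty (residual (u ++ [ a ]) L)

CanonOccurs : {A : Set} → Language A → Language A → Set₁
CanonOccurs {A} L X = ∃[ a ] ∃[ Y ] (CanonEdge L X a Y ⊎ CanonEdge L Y a X)

CanonVertex : {A : Set} → Language A → Set₁
CanonVertex L = Σ (Language _) (CanonOccurs L)

record IsoToCanonical {A V : Set} (E : V → A → V → Set) (L : Language A) : Set₁ where
  field
    f          : VertexSet E → CanonVertex L
    injective  : ∀ x y → proj₁ (f x) ≐ proj₁ (f y) → proj₁ x ≡ proj₁ y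
    surjective : ∀ (Y : CanonVertex L) → ∃[ x ] (proj₁ (f x) ≐ proj₁ Y)
    edges⇒     : ∀ x a y → E (proj₁ x) a (proj₁ y) → CanonEdge L (proj₁ (f x)) a (proj₁ (f y))
    edges⇐     : ∀ x a y → CanonEdge L (proj₁ (f x)) a (proj₁ (f y)) → E (proj₁ x) a (proj₁ y)

module Submission where

-- Write L(x) for the path language L_G(x,t) of words leading
-- from x to the fixed target t.  Determinism makes the residual of L(s)
-- by any word u equal to L(x), where x is the (unique) end of the path
-- s --u--> x; co-determinism makes x ↦ L(x) injective on vertices from
-- which t is reachable.  Hence, in a strongly connected graph, x ↦ L(x)
-- identifies the vertices of G with the non-empty residuals of L(s),
-- i.e. with the vertices of the canonical graph, and an edge
-- u⁻¹L --a--> (ua)⁻¹L of the canonical graph is exactly the image of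
-- the last edge of a path s --ua--> t.

open import Defs
open import Data.Product using (Σ; ∃-syntax; _×_; _,_; proj₁; proj₂)
open import Data.Sum using (inj₁; inj₂)
open import Data.List using ([]; _∷_; _++_; [_])
open import Data.List.Properties using (++-assoc)
open import Relation.Binary.PropositionalEquality using (_≡_; refl; subst)
open import Function.Bundles using (mk⇔; Equivalence)
open import Function.Properties.Equivalence using () renaming (sym to ⇔-sym; trans to ⇔-trans)

≐-sym : {A : Set} {L K : Language A} → L ≐ K → K ≐ L
≐-sym L≐K w = ⇔-sym (L≐K w)

≐-trans : {A : Set} {L K M : Language A} → L ≐ K → K ≐ M → L ≐ M
≐-trans L≐K K≐M w = ⇔-trans (L≐K w) (K≐M w)

module Paths {A V : Set} (E : V → A → V → Set) where

  _⟨++⟩_ : ∀ {s w r v t} → Path E s w r → Path E r v t → Path E s (w ++ v) t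
  nil      ⟨++⟩ q = q
  cons e p ⟨++⟩ q = cons e (p ⟨++⟩ q)

  split : ∀ {s t} w v → Path E s (w ++ v) t → ∃[ r ] (Path E s w r × Path E r v t)
  split []      v p = _ , nil , p
  split (a ∷ w) v (cons e p) with split w v p
  ... | r , p₁ , p₂ = r , cons e p₁ , p₂

  path-deterministic : Deterministic E →
    ∀ {s w r r′} → Path E s w r → Path E s w r′ → r ≡ r′
  path-deterministic D nil        nil          = refl
  path-deterministic D (cons e p) (cons e′ p′) with D e e′
  ... | refl = path-deterministic D p p′

  path-codeterministic : CoDeterministic E →
    ∀ {x y v t} → Path E x v t → Path E y v t → x ≡ y
  path-codeterministic C nil        nil          = refl
  path-codeterministic C (cons e p) (cons e′ p′) with path-codeterministic C p p′
  ... | refl = C e e′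

  end-occurs : ∀ {s w r} → Occurs E s → Path E s w r → Occurs E r
  end-occurs         s-occurs nil                = s-occurs
  end-occurs {s = s} s-occurs (cons {a = a} e p) = end-occurs (a , s , inj₂ e) p

module Languages {A V : Set} (E : V → A → V → Set) (t : V) where
  open Paths E

  L : V → Language A
  L x = PathLanguage E x t

  residual-language : Deterministic E →
    ∀ {s u x} → Path E s u x → L x ≐ residual u (L s)
  residual-language D {u = u} s→x v = mk⇔ (s→x ⟨++⟩_) restrict
    where
    restrict : residual u (L _) v → L _ v
    restrict p with split u v p
    ... | r , s→r , r→t with path-deterministic D s→x s→r
    ... | refl = r→t

  language-injective : CoDeterministic E →
    ∀ {x y v} → Path E x v t → L x ≐ L y → x ≡ y
  language-injective C {v = v} x→t Lx≐Ly =
    path-codeterministic C x→t (Equivalence.to (Lx≐Ly v) x→t)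

module CanonicalIsomorphism {A V : Set} (E : V → A → V → Set)
    (SC : StronglyConnected E) (D : Deterministic E) (C : CoDeterministic E)
    (s t : VertexSet E) where
  open Paths E
  open Languages E (proj₁ t)

  L₀ : Language A
  L₀ = L (proj₁ s)

  canonical-edge : ∀ {u x a y v} → Path E (proj₁ s) u x → E x a y → Path E y v (proj₁ t) →
    CanonEdge L₀ (L x) a (L y)
  canonical-edge {u} {x} {a} {y} s→x e y→t =
    u , residual-language D s→x , residual-language D s→y , _ , s→y ⟨++⟩ y→t
    where
    s→y : Path E (proj₁ s) (u ++ [ a ]) y
    s→y = s→x ⟨++⟩ cons e nil

  canonical-occurs : (x : VertexSet E) → CanonOccurs L₀ (L (proj₁ x))
  canonical-occurs x@(_ , a , w , inj₁ e) =
    a , L w , inj₁ (canonical-edge (proj₂ (SC s x)) e (proj₂ (SC (w , a , _ , inj₂ e) t)))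
  canonical-occurs x@(_ , a , w , inj₂ e) =
    a , L w , inj₂ (canonical-edge (proj₂ (SC s (w , a , _ , inj₁ e))) e (proj₂ (SC x t)))

  vertex-map : VertexSet E → CanonVertex L₀
  vertex-map x = L (proj₁ x) , canonical-occurs x

  vertex-map-injective : ∀ (x y : VertexSet E) → L (proj₁ x) ≐ L (proj₁ y) → proj₁ x ≡ proj₁ y
  vertex-map-injective x y = language-injective C (proj₂ (SC x t))

  residual-realised : ∀ u → NonEmpty (residual u L₀) →
    Σ (VertexSet E) λ r → L (proj₁ r) ≐ residual u L₀
  residual-realised u (v , p) with split u v p
  ... | r , s→r , _ = (r , end-occurs (proj₂ s) s→r) , residual-language D s→r

  nonempty-prefix : ∀ u a → NonEmpty (residual (u ++ [ a ]) L₀) → NonEmpty (residual u L₀)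
  nonempty-prefix u a (v , p) = a ∷ v , subst (λ w → L₀ w) (++-assoc u [ a ] v) p

  -- Both ends of a canonical edge are non-empty residuals, hence images.
  vertex-map-surjective : ∀ (Y : CanonVertex L₀) → Σ (VertexSet E) λ x → L (proj₁ x) ≐ proj₁ Y
  vertex-map-surjective (Y , a , _ , inj₁ (u , Y≐u⁻¹L₀ , _ , nonempty))
    with residual-realised u (nonempty-prefix u a nonempty)
  ... | r , Lr≐u⁻¹L₀ = r , ≐-trans Lr≐u⁻¹L₀ (≐-sym Y≐u⁻¹L₀)
  vertex-map-surjective (Y , a , _ , inj₂ (u , _ , Y≐ua⁻¹L₀ , nonempty))
    with residual-realised (u ++ [ a ]) nonempty
  ... | r , Lr≐ua⁻¹L₀ = r , ≐-trans Lr≐ua⁻¹L₀ (≐-sym Y≐ua⁻¹L₀)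

  vertex-map-preserves : ∀ (x : VertexSet E) a (y : VertexSet E) → E (proj₁ x) a (proj₁ y) →
    CanonEdge L₀ (L (proj₁ x)) a (L (proj₁ y))
  vertex-map-preserves x a y e = canonical-edge (proj₂ (SC s x)) e (proj₂ (SC y t))

  -- A canonical edge u⁻¹L₀ --a--> (ua)⁻¹L₀ comes from the last edge r --a--> r′
  -- of a path s --ua--> t; injectivity identifies r with x and r′ with y.
  vertex-map-reflects : ∀ (x : VertexSet E) a (y : VertexSet E) → CanonEdge L₀ (L (proj₁ x)) a (L (proj₁ y)) →
    E (proj₁ x) a (proj₁ y)
  vertex-map-reflects x a y (u , Lx≐u⁻¹L₀ , Ly≐ua⁻¹L₀ , v , p)
    with split (u ++ [ a ]) v p
  ... | r′ , s→r′ , _ with split u [ a ] s→r′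
  ... | r , s→r , cons e nil
    with vertex-map-injective x (r , a , r′ , inj₁ e)
           (≐-trans Lx≐u⁻¹L₀ (≐-sym (residual-language D s→r)))
       | vertex-map-injective y (r′ , a , r , inj₂ e)
           (≐-trans Ly≐ua⁻¹L₀ (≐-sym (residual-language D s→r′)))
  ... | refl | refl = e

corollary2p7 : {A V : Set} (E : V → A → V → Set) →
    StronglyConnected E → Deterministic E → CoDeterministic E →
    (s t : VertexSet E) →
    IsoToCanonical E (PathLanguage E (proj₁ s) (proj₁ t))
corollary2p7 E SC D C s t = record
  { f          = vertex-map
  ; injective  = vertex-map-injective
  ; surjective = vertex-map-surjective
  ; edges⇒     = vertex-map-preserves
  ; edges⇐     = vertex-map-reflects
  }
  where open CanonicalIsomorphism E SC D C s t
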